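{- For every graph $G$ we have $\mathrm{sa}_\ell(G)\leq \deg(G)+1$.
   Context: All graphs are finite and simple. The degeneracy $\deg(G)$ is the minimum, over all acyclic orientations of $G$, of the maximum out-degree. A star forest is a forest each of whose components is a star. The local star arboricity $\mathrm{sa}_\ell(G)$ is the minimum, over all families of star forests $S_1,\dots,S_k$ that are subgraphs of $G$ and whose edge sets together cover $E(G)$ ($k$ arbitrary), of the maximum over vertices $v$ of the number of indices $i$ with $v\in V(S_i)$. -}

module Defs where

open import Data.Nat using (ℕ; zero; suc; _+_; _≤_)
open import Data.Bool using (Bool; true; false)
open import Data.Fin using (Fin)
import Data.Fin
open import Data.Product using (Σ; ∃; _×_; _,_)
open import Data.Sum using (_⊎_)
open import Relation.Nullary using (¬_)
open import Relation.Binary.PropositionalEquality using (_≡_)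
open import Relation.Binary.Construct.Closure.Transitive using (TransClosure)
open import Relation.Binary.Construct.Closure.ReflexiveTransitive using (Star)

count : ∀ {n} → (Fin n → Bool) → ℕ
count {zero}  p = 0
count {suc n} p with p Fin.zero
... | true  = suc (count (λ i → p (Fin.suc i)))
... | false = count (λ i → p (Fin.suc i))

record Graph : Set where
  field
    n     : ℕ
    adj   : Fin n → Fin n → Bool
    sym   : ∀ u v → adj u v ≡ true → adj v u ≡ true
    irrefl : ∀ v → adj v v ≡ false
open Graph public

record Orientation (G : Graph) : Set where
  field
    arc      : Fin (n G) → Fin (n G) → Bool
    arc⊆adj  : ∀ u v → arc u v ≡ true → adj G u v ≡ true
    total    : ∀ u v → adj G u v ≡ true → arc u v ≡ true ⊎ arc v u ≡ true
    antisym  : ∀ u v → arc u v ≡ true → arc v u ≡ false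
open Orientation public

Arc : ∀ {G} → Orientation G → Fin (n G) → Fin (n G) → Set
Arc O u v = arc O u v ≡ true

Acyclic : ∀ {G} → Orientation G → Set
Acyclic {G} O = ∀ (v : Fin (n G)) → ¬ TransClosure (Arc O) v v

outdeg : ∀ {G} → Orientation G → Fin (n G) → ℕ
outdeg O v = count (λ w → arc O v w)

-- deg(G) ≤ d : some acyclic orientation has maximum out-degree ≤ d
DegAtMost : Graph → ℕ → Set
DegAtMost G d =
  Σ (Orientation G) λ O → Acyclic O × (∀ v → outdeg O v ≤ d)

record Subgraph (G : Graph) : Set where
  field
    vert     : Fin (n G) → Bool
    edge     : Fin (n G) → Fin (n G) → Bool
    edge-sym : ∀ u v → edge u v ≡ true → edge v u ≡ true
    edge⊆adj : ∀ u v → edge u v ≡ true → adj G u v ≡ true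
    edge-vert : ∀ u v → edge u v ≡ true → vert u ≡ true
open Subgraph public

Edge : ∀ {G} → Subgraph G → Fin (n G) → Fin (n G) → Set
Edge S u v = edge S u v ≡ true

Connected : ∀ {G} → Subgraph G → Fin (n G) → Fin (n G) → Set
Connected S = Star (Edge S)

-- S is a star forest: every component of S is a star, i.e. the component of
-- each vertex v has a vertex c (the centre) such that every edge of the
-- component is incident with c.  (A connected simple graph all of whose
-- edges contain a fixed vertex c is exactly a star K_{1,m} centred at c.)
IsStarForest : ∀ {G} → Subgraph G → Set
IsStarForest {G} S =
  ∀ (v : Fin (n G)) → vert S v ≡ true →
    Σ (Fin (n G)) λ c → vert S c ≡ true × Connected S c v ×
      (∀ x y → Edge S x y → Connected S c x → x ≡ c ⊎ y ≡ c)

-- sa_ℓ(G) ≤ t : there are star forests S_1..S_k in G covering E(G) such that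
-- every vertex lies in at most t of them.
LocalStarArbAtMost : Graph → ℕ → Set
LocalStarArbAtMost G t =
  Σ ℕ λ k → Σ (Fin k → Subgraph G) λ S →
    (∀ i → IsStarForest (S i)) ×
    (∀ u v → adj G u v ≡ true → ∃ λ i → Edge (S i) u v) ×
    (∀ v → count (λ i → vert (S i) v) ≤ t)

module Submission where

-- Fix an orientation O of G in which every out-degree is at most d.  For each vertex w let S_w be the "in-star" of w: its edges
-- are the arcs x → w, its vertices are w and the tails of those arcs.  Each
-- S_w is a single star centred at w, hence a star forest, and every edge uv of
-- G lies in S_v or S_u according to its orientation.  A vertex v belongs to
-- S_w exactly when v = w or v → w, so v lies in at most 1 + outdeg(v) ≤ d + 1
-- of the stars.

open import Defs
open import Data.Nat using (ℕ; zero; suc; _+_; _≤_; z≤n; s≤s)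
open import Data.Nat.Properties using (+-suc; m≤n⇒m≤1+n; +-mono-≤; ≤-trans; ≤-refl; ≤-reflexive)
open import Data.Fin using (Fin)
import Data.Fin as F
open import Data.Fin.Properties using (_≟_)
open import Data.Bool using (Bool; true; false; _∨_; _∧_)
open import Data.Bool.Properties using (∨-comm)
open import Data.Product using (∃; _×_; _,_)
open import Data.Sum using (_⊎_; inj₁; inj₂)
open import Relation.Nullary using (does; yes)
open import Relation.Nullary.Decidable using (dec-true)
open import Relation.Binary.PropositionalEquality using (_≡_; refl; cong; trans) renaming (sym to ≡-sym)
open import Relation.Binary.Construct.Closure.ReflexiveTransitive using (ε; _◅_)

is : ∀ {n} → Fin n → Fin n → Bool
is v i = does (v ≟ i)

is-sound : ∀ {n} {v i : Fin n} → is v i ≡ true → v ≡ i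
is-sound {v = v} {i} eq with v ≟ i
... | yes v≡i = v≡i

is-refl : ∀ {n} (v : Fin n) → is v v ≡ true
is-refl v = dec-true (v ≟ v) refl

∧-true : ∀ {a b} → a ∧ b ≡ true → a ≡ true × b ≡ true
∧-true {true} {true} refl = refl , refl

∨-true : ∀ {a b} → a ∨ b ≡ true → a ≡ true ⊎ b ≡ true
∨-true {true}  _  = inj₁ refl
∨-true {false} eq = inj₂ eq

count-false : ∀ {n} → count {n} (λ _ → false) ≡ 0
count-false {zero}  = refl
count-false {suc n} = count-false {n}

count-∨ : ∀ {n} (f g : Fin n → Bool) →
          count (λ i → f i ∨ g i) ≤ count f + count g
count-∨ {zero}  f g = z≤n
count-∨ {suc n} f g with f F.zero | g F.zero | count-∨ (λ i → f (F.suc i)) (λ i → g (F.suc i))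
... | true  | true  | ih = s≤s (≤-trans (m≤n⇒m≤1+n ih) (≤-reflexive (≡-sym (+-suc _ _))))
... | true  | false | ih = s≤s ih
... | false | true  | ih = ≤-trans (s≤s ih) (≤-reflexive (≡-sym (+-suc _ _)))
... | false | false | ih = ih

count-is : ∀ {n} (v : Fin n) → count (is v) ≡ 1
count-is {suc n} F.zero    = cong suc (count-false {n})
count-is {suc n} (F.suc v) = count-is v

module InStars {G : Graph} (O : Orientation G) where

  V : Set
  V = Fin (n G)

  inVert : V → V → Bool
  inVert w x = is x w ∨ arc O x w

  inEdge : V → V → V → Bool
  inEdge w x y = (is x w ∧ arc O y w) ∨ (is y w ∧ arc O x w)

  inEdge-sym : ∀ w x y → inEdge w x y ≡ true → inEdge w y x ≡ true
  inEdge-sym w x y = trans (∨-comm (is y w ∧ arc O x w) (is x w ∧ arc O y w))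

  inEdge-inv : ∀ w x y → inEdge w x y ≡ true →
               (x ≡ w × Arc O y w) ⊎ (y ≡ w × Arc O x w)
  inEdge-inv w x y e with ∨-true {is x w ∧ arc O y w} e
  ... | inj₁ e₁ with ∧-true e₁
  ...   | x≡w , y→w = inj₁ (is-sound x≡w , y→w)
  inEdge-inv w x y e | inj₂ e₂ with ∧-true e₂
  ...   | y≡w , x→w = inj₂ (is-sound y≡w , x→w)

  inEdge-adj : ∀ w x y → inEdge w x y ≡ true → adj G x y ≡ true
  inEdge-adj w x y e with inEdge-inv w x y e
  ... | inj₁ (refl , y→x) = Graph.sym G y x (arc⊆adj O y x y→x)
  ... | inj₂ (refl , x→y) = arc⊆adj O x y x→y

  inEdge-vert : ∀ w x y → inEdge w x y ≡ true → inVert w x ≡ true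
  inEdge-vert w x y e with inEdge-inv w x y e
  ... | inj₁ (refl , _)   rewrite is-refl x = refl
  ... | inj₂ (refl , x→y) rewrite x→y = ∨-comm (is x y) true

  inStar : V → Subgraph G
  inStar w = record
    { vert      = inVert w
    ; edge      = inEdge w
    ; edge-sym  = inEdge-sym w
    ; edge⊆adj  = inEdge-adj w
    ; edge-vert = inEdge-vert w
    }

  arc-inEdge : ∀ {w v} → Arc O v w → Edge (inStar w) w v
  arc-inEdge {w} {v} v→w rewrite is-refl w | v→w = refl

  inStar-star : ∀ w → IsStarForest (inStar w)
  inStar-star w v v∈S = w , centre , reach (∨-true v∈S) , incident
    where
    centre : inVert w w ≡ true
    centre rewrite is-refl w = refl
    reach : is v w ≡ true ⊎ Arc O v w → Connected (inStar w) w v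
    reach (inj₁ v≡w) with is-sound {v = v} {w} v≡w
    ... | refl = ε
    reach (inj₂ v→w) = arc-inEdge v→w ◅ ε
    incident : ∀ x y → Edge (inStar w) x y → Connected (inStar w) w x → x ≡ w ⊎ y ≡ w
    incident x y e _ with inEdge-inv w x y e
    ... | inj₁ (x≡w , _) = inj₁ x≡w
    ... | inj₂ (y≡w , _) = inj₂ y≡w

  inStar-cover : ∀ u v → adj G u v ≡ true → ∃ λ w → Edge (inStar w) u v
  inStar-cover u v uv with total O u v uv
  ... | inj₁ u→v = v , inEdge-sym v v u (arc-inEdge u→v)
  ... | inj₂ v→u = u , arc-inEdge v→u

  inStar-load : ∀ v → count (λ w → inVert w v) ≤ suc (outdeg O v)
  inStar-load v = ≤-trans (count-∨ (is v) (arc O v))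
                          (+-mono-≤ (≤-reflexive (count-is v)) ≤-refl)

orientation⇒localStarArb : ∀ {G d} (O : Orientation G) →
  (∀ v → outdeg O v ≤ d) → LocalStarArbAtMost G (suc d)
orientation⇒localStarArb {G} O outdeg≤d =
  n G , inStar , inStar-star , inStar-cover ,
  λ v → ≤-trans (inStar-load v) (s≤s (outdeg≤d v))
  where open InStars O

-- The orientation witnessing deg(G) ≤ d suffices.
corollary10 : ∀ (G : Graph) (d : ℕ) → DegAtMost G d → LocalStarArbAtMost G (suc d)
corollary10 G d (O , _ , outdeg≤d) = orientation⇒localStarArb O outdeg≤d
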